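{- Let $n$ and $m$ be integers with $n\geq m\geq 3$, and let $M=(m_1,\ldots,m_t)$ be a list of integers with $m_1+\cdots+m_t=m$ and $m_i\geq 2$ for all $i$. Then there is a subgraph $G$ of $2K_n$ such that $G$ admits both an $(M,n)$-decomposition and an $(m,n)$-decomposition.
   Context: $2K_n$ is the multigraph on $n$ vertices with each pair of distinct vertices joined by two edges. For $m\geq 2$ an $m$-cycle has $m$ distinct vertices $v_1,\dots,v_m$ and edges $v_1v_2,\dots,v_mv_1$ (a $2$-cycle is two parallel edges). For a list $L=(l_1,\ldots,l_s)$, an $(L)$-decomposition of a graph $G$ is a partition of $E(G)$ into cycles $G_1,\ldots,G_s$ with $G_i$ an $l_i$-cycle; $(M,n)$ is $M$ with the entry $n$ appended. -}

module Defs where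

open import Data.Nat using (ℕ; _≤_; _+_)
open import Data.Fin using (Fin)
open import Data.Fin.Properties using () renaming (_≟_ to _≟ᶠ_)
open import Data.List using (List; []; _∷_; _++_; [_]; zip; length; map)
open import Data.Nat.ListAction using (sum)
open import Data.List.Relation.Unary.Unique.Propositional using (Unique)
open import Data.List.Relation.Binary.Pointwise using (Pointwise)
open import Data.Product using (Σ; _×_; _,_)
open import Relation.Binary.PropositionalEquality using (_≡_; _≢_)
open import Relation.Nullary using (yes; no)

record SubMultigraph2K (n : ℕ) : Set where
  field
    mult     : Fin n → Fin n → ℕ
    symm     : ∀ u v → mult u v ≡ mult v u
    loopless : ∀ u → mult u u ≡ 0
    atMost2  : ∀ u v → mult u v ≤ 2
open SubMultigraph2K public

-- The list of edges (as ordered pairs) of the closed walk v1 v2 ... vm v1.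
cycleEdges : ∀ {n} → List (Fin n) → List (Fin n × Fin n)
cycleEdges []       = []
cycleEdges (x ∷ xs) = zip (x ∷ xs) (xs ++ [ x ])

joins : ∀ {n} → Fin n → Fin n → Fin n × Fin n → ℕ
joins u v (a , b) with a ≟ᶠ u | b ≟ᶠ v | a ≟ᶠ v | b ≟ᶠ u
... | yes _ | yes _ | _     | _     = 1
... | _     | _     | yes _ | yes _ = 1
... | _     | _     | _     | _     = 0

edgeMult : ∀ {n} → Fin n → Fin n → List (Fin n) → ℕ
edgeMult u v vs = sum (map (joins u v) (cycleEdges vs))

IsCycle : ∀ {n} → ℕ → List (Fin n) → Set
IsCycle l vs = (length vs ≡ l) × (2 ≤ l) × Unique vs

-- An (L)-decomposition of G: cycles G_1..G_s with G_i an l_i-cycle whose edge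
-- multisets partition the edge multiset of G.
Decomposition : ∀ {n} → SubMultigraph2K n → List ℕ → Set
Decomposition {n} G L =
  Σ (List (List (Fin n))) λ cycles →
    Pointwise IsCycle L cycles ×
    (∀ u v → u ≢ v → sum (map (edgeMult u v) cycles) ≡ mult G u v)

module Submission where

-- Idea: on the vertices 0,…,n−1 build an m-cycle D and a Hamilton cycle C, and
-- cycles of the lengths M plus a Hamilton cycle B carrying the same edges; then
-- G = D ∪ C.  Such a configuration (a `Switch`) is built by induction on M: for a
-- single block D = (0, x+1, …, n−1), B = (0, 1, …, n−1) and C = B reversed, with
-- x = n − m spare vertices; a new block of fresh vertices is spliced into D and C
-- just before they return to 0, and B is rerouted through it (`switch-identity`).
-- Edge multisets are compared through weights: both families have the same total
-- for every symmetric weight on vertex pairs, in particular for the indicator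
-- `joins u v` of a pair.

open import Defs
open import Data.Nat using (ℕ; _≤_)
open import Data.List using (List; _∷_; []; _++_; [_])
open import Data.Nat.ListAction using (sum)
open import Data.List.Relation.Unary.All using (All)
open import Data.Product using (Σ; _×_)
open import Relation.Binary.PropositionalEquality using (_≡_)

open import Data.Nat using (zero; suc; _+_; _∸_; _<_; z≤n; s≤s; NonZero; >-nonZero)
open import Data.Nat.Properties
  using (+-assoc; +-comm; +-identityʳ; +-mono-≤; ≤-trans; ≤-refl; ≤-reflexive; n≤1+n; m≤m+n;
         <-≤-trans; <-irrefl; +-suc; m+[n∸m]≡n)
open import Data.Nat.DivMod using (_mod_; _%_; m%n<n; m<n⇒m%n≡m)
open import Data.Nat.ListAction.Properties using (sum-++)
open import Data.Nat.Tactic.RingSolver using (solve-∀)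
open import Data.Fin using (Fin)
open import Data.Fin.Properties using (fromℕ<-injective) renaming (_≟_ to _≟ᶠ_)
open import Data.List using (length; map; zip; reverse)
open import Data.List.Properties using (unfold-reverse; length-++; length-map; map-++; map-cong; ++-assoc)
open import Data.List.Relation.Unary.All as All using ([]; _∷_)
open import Data.List.Relation.Unary.All.Properties using () renaming (++⁺ to All-++⁺)
open import Data.List.Relation.Unary.Any using (here; there)
open import Data.List.Relation.Unary.AllPairs using ([]; _∷_)
open import Data.List.Membership.Propositional using (_∈_; _∉_)
open import Data.List.Relation.Unary.Unique.Propositional using (Unique)
open import Data.List.Relation.Unary.Unique.Propositional.Properties
  using (Unique[x∷xs]⇒x∉xs) renaming (++⁺ to Unique-++⁺)
open import Data.List.Relation.Binary.Permutation.Propositional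
  using (_↭_; ↭-refl; ↭-sym; ↭-prep; ↭⇒↭ₛ; module PermutationReasoning)
open import Data.List.Relation.Binary.Permutation.Propositional.Properties
  using (All-resp-↭; ↭-reverse; ∷↭∷ʳ; ↭-length) renaming (++⁺ to ↭-++⁺)
open import Data.List.Relation.Binary.Pointwise using (Pointwise; []; _∷_) renaming (++⁺ to Pointwise-++⁺)
open import Data.Product using (_,_)
open import Data.Sum using (_⊎_; inj₁; inj₂) renaming (swap to ⊎-swap)
open import Data.Empty using (⊥-elim)
open import Relation.Nullary using (¬_; yes; no)
open import Relation.Binary.PropositionalEquality
  using (_≢_; refl; sym; trans; cong; cong₂; subst; setoid; module ≡-Reasoning)
open import Function using (_∘_)
open import Data.List.Relation.Binary.Permutation.Setoid.Properties (setoid ℕ) using (Unique-resp-↭)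

private
  variable
    A A′ : Set

Weight : Set → Set
Weight A = A × A → ℕ

Symmetric : Weight A → Set
Symmetric w = ∀ x y → w (x , y) ≡ w (y , x)

last : A → List A → A
last x []       = x
last x (y ∷ ys) = last y ys

last-++ : ∀ (x : A) L₁ L₂ → last x (L₁ ++ L₂) ≡ last (last x L₁) L₂
last-++ x []       L₂ = refl
last-++ x (y ∷ L₁) L₂ = last-++ y L₁ L₂

last-∈ : ∀ (x : A) L → last x L ∈ x ∷ L
last-∈ x []       = here refl
last-∈ x (y ∷ L) = there (last-∈ y L)

pathWeight : Weight A → A → List A → ℕ
pathWeight w x []       = 0
pathWeight w x (y ∷ ys) = w (x , y) + pathWeight w y ys

pathWeight-++ : ∀ (w : Weight A) x L₁ L₂ →
  pathWeight w x (L₁ ++ L₂) ≡ pathWeight w x L₁ + pathWeight w (last x L₁) L₂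
pathWeight-++ w x []       L₂ = refl
pathWeight-++ w x (y ∷ L₁) L₂ =
  trans (cong (w (x , y) +_) (pathWeight-++ w y L₁ L₂)) (sym (+-assoc (w (x , y)) _ _))

cycleWeight : Weight A → List A → ℕ
cycleWeight w []      = 0
cycleWeight w (x ∷ L) = pathWeight w x L + w (last x L , x)

totalWeight : Weight A → List (List A) → ℕ
totalWeight w Cs = sum (map (cycleWeight w) Cs)

totalWeight-snoc : ∀ (w : Weight A) Cs C → totalWeight w (Cs ++ [ C ]) ≡ totalWeight w Cs + cycleWeight w C
totalWeight-snoc w Cs C = begin
  sum (map (cycleWeight w) (Cs ++ [ C ]))                   ≡⟨ cong sum (map-++ (cycleWeight w) Cs [ C ]) ⟩
  sum (map (cycleWeight w) Cs ++ [ cycleWeight w C ])       ≡⟨ sum-++ (map (cycleWeight w) Cs) _ ⟩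
  totalWeight w Cs + (cycleWeight w C + 0)                  ≡⟨ cong (totalWeight w Cs +_) (+-identityʳ _) ⟩
  totalWeight w Cs + cycleWeight w C                        ∎
  where open ≡-Reasoning

zip-weight : ∀ (w : Weight A) x L y →
  sum (map w (zip (x ∷ L) (L ++ [ y ]))) ≡ pathWeight w x L + w (last x L , y)
zip-weight w x []      y = +-identityʳ (w (x , y))
zip-weight w x (z ∷ L) y =
  trans (cong (w (x , z) +_) (zip-weight w z L y)) (sym (+-assoc (w (x , z)) _ _))

-- The walk x, L read backwards is  last x L ∷ reversedWalk x L.
reversedWalk : A → List A → List A
reversedWalk x []      = []
reversedWalk x (y ∷ L) = reversedWalk y L ++ [ x ]

reverse-∷ : ∀ (x : A) L → reverse (x ∷ L) ≡ last x L ∷ reversedWalk x L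
reverse-∷ x []      = refl
reverse-∷ x (y ∷ L) = trans (unfold-reverse x (y ∷ L)) (cong (_++ [ x ]) (reverse-∷ y L))

reversedWalk-↭ : ∀ (x : A) L → last x L ∷ reversedWalk x L ↭ x ∷ L
reversedWalk-↭ x L = subst (_↭ x ∷ L) (reverse-∷ x L) (↭-reverse (x ∷ L))

last-reversedWalk : ∀ (x : A) L → last (last x L) (reversedWalk x L) ≡ x
last-reversedWalk x []      = refl
last-reversedWalk x (y ∷ L) = last-++ (last y L) (reversedWalk y L) [ x ]

pathWeight-reverse : ∀ (w : Weight A) → Symmetric w → ∀ x L →
  pathWeight w (last x L) (reversedWalk x L) ≡ pathWeight w x L
pathWeight-reverse w w-sym x []      = refl
pathWeight-reverse w w-sym x (y ∷ L) = begin
  pathWeight w (last y L) (reversedWalk y L ++ [ x ])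
    ≡⟨ pathWeight-++ w (last y L) (reversedWalk y L) [ x ] ⟩
  pathWeight w (last y L) (reversedWalk y L) + (w (last (last y L) (reversedWalk y L) , x) + 0)
    ≡⟨ cong₂ (λ p t → p + (w (t , x) + 0)) (pathWeight-reverse w w-sym y L) (last-reversedWalk y L) ⟩
  pathWeight w y L + (w (y , x) + 0)
    ≡⟨ cong (pathWeight w y L +_) (trans (+-identityʳ _) (w-sym y x)) ⟩
  pathWeight w y L + w (x , y)
    ≡⟨ +-comm (pathWeight w y L) _ ⟩
  w (x , y) + pathWeight w y L
    ∎
  where open ≡-Reasoning

pullback : (A → A′) → Weight A′ → Weight A
pullback f w (x , y) = w (f x , f y)

last-map : ∀ (f : A → A′) x L → last (f x) (map f L) ≡ f (last x L)
last-map f x []      = refl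
last-map f x (y ∷ L) = last-map f y L

pathWeight-map : ∀ (f : A → A′) w x L → pathWeight w (f x) (map f L) ≡ pathWeight (pullback f w) x L
pathWeight-map f w x []      = refl
pathWeight-map f w x (y ∷ L) = cong (w (f x , f y) +_) (pathWeight-map f w y L)

cycleWeight-map : ∀ (f : A → A′) w L → cycleWeight w (map f L) ≡ cycleWeight (pullback f w) L
cycleWeight-map f w []      = refl
cycleWeight-map f w (x ∷ L) =
  cong₂ _+_ (pathWeight-map f w x L) (cong (λ t → w (t , f x)) (last-map f x L))

switch-arithmetic : ∀ PD PC PB S b b′ c PY PI → PD + PC ≡ S + PB →
  (PD + (b + PY)) + (PC + (b′ + (c + PI))) ≡ ((PY + c) + S) + (b′ + (PB + (b + PI)))
switch-arithmetic PD PC PB S b b′ c PY PI paths = begin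
  (PD + (b + PY)) + (PC + (b′ + (c + PI)))  ≡⟨ regroup PD PC b b′ c PY PI ⟩
  (PD + PC) + (b + b′ + c + PY + PI)        ≡⟨ cong (_+ (b + b′ + c + PY + PI)) paths ⟩
  (S + PB) + (b + b′ + c + PY + PI)         ≡⟨ sym (regroup′ S PB b b′ c PY PI) ⟩
  ((PY + c) + S) + (b′ + (PB + (b + PI)))   ∎
  where
    open ≡-Reasoning
    regroup : ∀ PD PC b b′ c PY PI → (PD + (b + PY)) + (PC + (b′ + (c + PI))) ≡ (PD + PC) + (b + b′ + c + PY + PI)
    regroup = solve-∀
    regroup′ : ∀ S PB b b′ c PY PI → ((PY + c) + S) + (b′ + (PB + (b + PI))) ≡ (S + PB) + (b + b′ + c + PY + PI)
    regroup′ = solve-∀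

switch-identity : ∀ (w : Weight A) → Symmetric w → ∀ o Dt Ct r Bt e I z S →
  last o Ct ≡ r → last o Dt ≡ last r Bt →
  pathWeight w o Dt + pathWeight w o Ct ≡ S + pathWeight w r Bt →
  pathWeight w o (Dt ++ e ∷ I ++ [ z ]) + pathWeight w o (Ct ++ z ∷ e ∷ I)
    ≡ (cycleWeight w (e ∷ I ++ [ z ]) + S) + pathWeight w z (r ∷ Bt ++ e ∷ I)
switch-identity {A = A} w w-sym o Dt Ct r Bt e I z S C-anchor D-anchor paths = begin
  pathWeight w o (Dt ++ e ∷ Y) + pathWeight w o (Ct ++ z ∷ e ∷ I)
    ≡⟨ cong₂ _+_ (pathWeight-++ w o Dt (e ∷ Y)) (pathWeight-++ w o Ct (z ∷ e ∷ I)) ⟩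
  (PD + (w (last o Dt , e) + PY)) + (PC + (w (last o Ct , z) + (w (z , e) + PI)))
    ≡⟨ switch-arithmetic PD PC PB S (w (last o Dt , e)) (w (last o Ct , z)) (w (z , e)) PY PI paths ⟩
  ((PY + w (z , e)) + S) + (w (last o Ct , z) + (PB + (w (last o Dt , e) + PI)))
    ≡⟨ sym (cong₂ _+_ new-cycle new-walk) ⟩
  (cycleWeight w (e ∷ Y) + S) + pathWeight w z (r ∷ Bt ++ e ∷ I)
    ∎
  where
    open ≡-Reasoning
    Y : List A
    Y  = I ++ [ z ]
    PD PC PB PY PI : ℕ
    PD = pathWeight w o Dt
    PC = pathWeight w o Ct
    PB = pathWeight w r Bt
    PY = pathWeight w e Y
    PI = pathWeight w e I
    new-cycle : cycleWeight w (e ∷ Y) + S ≡ (PY + w (z , e)) + S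
    new-cycle = cong (λ t → (PY + w (t , e)) + S) (last-++ e I [ z ])
    new-walk : pathWeight w z (r ∷ Bt ++ e ∷ I) ≡ w (last o Ct , z) + (PB + (w (last o Dt , e) + PI))
    new-walk = cong₂ _+_
      (trans (w-sym z r) (cong (λ t → w (t , z)) (sym C-anchor)))
      (trans (pathWeight-++ w r Bt (e ∷ I)) (cong (λ t → PB + (w (t , e) + PI)) (sym D-anchor)))

Joins : ∀ {n} → Fin n → Fin n → Fin n × Fin n → Set
Joins u v (a , b) = (a ≡ u × b ≡ v) ⊎ (a ≡ v × b ≡ u)

joins-spec : ∀ {n} (u v : Fin n) e → (joins u v e ≡ 1 × Joins u v e) ⊎ (joins u v e ≡ 0 × ¬ Joins u v e)
joins-spec u v (a , b) with a ≟ᶠ u | b ≟ᶠ v | a ≟ᶠ v | b ≟ᶠ u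
... | yes a≡u | yes b≡v | _       | _       = inj₁ (refl , inj₁ (a≡u , b≡v))
... | yes _   | no _    | yes a≡v | yes b≡u = inj₁ (refl , inj₂ (a≡v , b≡u))
... | yes _   | no b≢v  | yes _   | no b≢u  = inj₂ (refl , λ { (inj₁ (_ , q)) → b≢v q ; (inj₂ (_ , q)) → b≢u q })
... | yes _   | no b≢v  | no a≢v  | _       = inj₂ (refl , λ { (inj₁ (_ , q)) → b≢v q ; (inj₂ (p , _)) → a≢v p })
... | no _    | _       | yes a≡v | yes b≡u = inj₁ (refl , inj₂ (a≡v , b≡u))
... | no a≢u  | _       | yes _   | no b≢u  = inj₂ (refl , λ { (inj₁ (p , _)) → a≢u p ; (inj₂ (_ , q)) → b≢u q })
... | no a≢u  | _       | no a≢v  | _       = inj₂ (refl , λ { (inj₁ (p , _)) → a≢u p ; (inj₂ (p , _)) → a≢v p })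

joins-resp : ∀ {n} {u v u′ v′ : Fin n} {e e′} →
  (Joins u v e → Joins u′ v′ e′) → (Joins u′ v′ e′ → Joins u v e) → joins u v e ≡ joins u′ v′ e′
joins-resp {u = u} {v} {u′} {v′} {e} {e′} to from with joins-spec u v e | joins-spec u′ v′ e′
... | inj₁ (p , _)  | inj₁ (q , _)  = trans p (sym q)
... | inj₁ (_ , j)  | inj₂ (_ , ¬j) = ⊥-elim (¬j (to j))
... | inj₂ (_ , ¬j) | inj₁ (_ , j)  = ⊥-elim (¬j (from j))
... | inj₂ (p , _)  | inj₂ (q , _)  = trans p (sym q)

joins-sym : ∀ {n} (u v : Fin n) a b → joins u v (a , b) ≡ joins u v (b , a)
joins-sym u v a b = joins-resp flip flip
  where
    flip : ∀ {a b} → Joins u v (a , b) → Joins u v (b , a)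
    flip (inj₁ (p , q)) = inj₂ (q , p)
    flip (inj₂ (p , q)) = inj₁ (q , p)

joins-swap : ∀ {n} (u v : Fin n) e → joins u v e ≡ joins v u e
joins-swap u v e = joins-resp ⊎-swap ⊎-swap

joins-fst : ∀ {n} {u v a b : Fin n} → Joins u v (a , b) → a ≡ u ⊎ a ≡ v
joins-fst (inj₁ (a≡u , _)) = inj₁ a≡u
joins-fst (inj₂ (a≡v , _)) = inj₂ a≡v

joins-snd : ∀ {n} {u v a b : Fin n} → Joins u v (a , b) → b ≡ u ⊎ b ≡ v
joins-snd (inj₁ (_ , b≡v)) = inj₂ b≡v
joins-snd (inj₂ (_ , b≡u)) = inj₁ b≡u

joins-ends : ∀ {n} {u v a b z : Fin n} → Joins u v (a , b) → z ≡ u ⊎ z ≡ v → z ≡ a ⊎ z ≡ b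
joins-ends (inj₁ (a≡u , _))   (inj₁ z≡u) = inj₁ (trans z≡u (sym a≡u))
joins-ends (inj₁ (_   , b≡v)) (inj₂ z≡v) = inj₂ (trans z≡v (sym b≡v))
joins-ends (inj₂ (_   , b≡u)) (inj₁ z≡u) = inj₂ (trans z≡u (sym b≡u))
joins-ends (inj₂ (a≡v , _))   (inj₂ z≡v) = inj₁ (trans z≡v (sym a≡v))

joins-partner : ∀ {n} {u v a b c : Fin n} → Joins u v (a , b) → Joins u v (c , a) → c ≢ a → b ≡ c
joins-partner (inj₁ (a≡u , _))   (inj₁ (c≡u , _)) c≢a = ⊥-elim (c≢a (trans c≡u (sym a≡u)))
joins-partner (inj₁ (_   , b≡v)) (inj₂ (c≡v , _)) _   = trans b≡v (sym c≡v)
joins-partner (inj₂ (_   , b≡u)) (inj₁ (c≡u , _)) _   = trans b≡u (sym c≡u)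
joins-partner (inj₂ (a≡v , _))   (inj₂ (c≡v , _)) c≢a = ⊥-elim (c≢a (trans c≡v (sym a≡v)))

module _ {n : ℕ} (u v : Fin n) where

  pathWeight-avoid : ∀ {z} → z ≡ u ⊎ z ≡ v → ∀ x L → z ∉ x ∷ L → pathWeight (joins u v) x L ≡ 0
  pathWeight-avoid z∈uv x []      _   = refl
  pathWeight-avoid z∈uv x (y ∷ L) z∉ with joins-spec u v (x , y)
  ... | inj₂ (j≡0 , _) = trans (cong (_+ _) j≡0) (pathWeight-avoid z∈uv y L (z∉ ∘ there))
  ... | inj₁ (_ , j) with joins-ends j z∈uv
  ...   | inj₁ z≡x = ⊥-elim (z∉ (here z≡x))
  ...   | inj₂ z≡y = ⊥-elim (z∉ (there (here z≡y)))

  pathWeight-simple : ∀ x L → Unique (x ∷ L) → pathWeight (joins u v) x L ≤ 1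
  pathWeight-simple x []      _ = z≤n
  pathWeight-simple x (y ∷ L) uq@(_ ∷ uL) with joins-spec u v (x , y)
  ... | inj₂ (j≡0 , _) = subst (_≤ 1) (sym (cong (_+ _) j≡0)) (pathWeight-simple y L uL)
  ... | inj₁ (j≡1 , j) =
    ≤-reflexive (cong₂ _+_ j≡1 (pathWeight-avoid (joins-fst j) y L (Unique[x∷xs]⇒x∉xs uq)))

  cycleWeight-simple : ∀ L → Unique L → 3 ≤ length L → cycleWeight (joins u v) L ≤ 1
  cycleWeight-simple (_ ∷ [])         _ (s≤s ())
  cycleWeight-simple (_ ∷ _ ∷ [])     _ (s≤s (s≤s ()))
  cycleWeight-simple (x ∷ y ∷ z ∷ L) uq@(_ ∷ uq′) _
    with joins-spec u v (last z L , x) | joins-spec u v (x , y)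
  ... | inj₂ (closing≡0 , _) | _ =
    subst (_≤ 1) (sym (trans (cong (pathWeight (joins u v) x (y ∷ z ∷ L) +_) closing≡0) (+-identityʳ _)))
      (pathWeight-simple x (y ∷ z ∷ L) uq)
  ... | inj₁ (_ , closing) | inj₁ (_ , first) =
    ⊥-elim (Unique[x∷xs]⇒x∉xs uq′ (subst (_∈ z ∷ L) (sym (joins-partner first closing last≢x)) (last-∈ z L)))
    where
      last≢x : last z L ≢ x
      last≢x eq = Unique[x∷xs]⇒x∉xs uq (there (subst (_∈ z ∷ L) eq (last-∈ z L)))
  ... | inj₁ (closing≡1 , closing) | inj₂ (first≡0 , _) =
    ≤-reflexive (cong₂ _+_ (cong₂ _+_ first≡0 rest≡0) closing≡1)
    where
      rest≡0 : pathWeight (joins u v) y (z ∷ L) ≡ 0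
      rest≡0 = pathWeight-avoid (joins-snd closing) y (z ∷ L) (Unique[x∷xs]⇒x∉xs uq)

  edgeMult-cycleWeight : ∀ L → edgeMult u v L ≡ cycleWeight (joins u v) L
  edgeMult-cycleWeight []      = refl
  edgeMult-cycleWeight (x ∷ L) = zip-weight (joins u v) x L x

  edgeMult-simple : ∀ L → Unique L → 3 ≤ length L → edgeMult u v L ≤ 1
  edgeMult-simple L uq long = subst (_≤ 1) (sym (edgeMult-cycleWeight L)) (cycleWeight-simple L uq long)

  edgeMult-swap : ∀ L → edgeMult u v L ≡ edgeMult v u L
  edgeMult-swap L = cong sum (map-cong (joins-swap u v) (cycleEdges L))

-- A simple cycle of length at least 3, so it uses every pair at most once.
LongSimple : ∀ {n} → List (Fin n) → Set
LongSimple L = Unique L × 3 ≤ length L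

unionMult : ∀ {n} → List (Fin n) → List (Fin n) → Fin n → Fin n → ℕ
unionMult D C u v with u ≟ᶠ v
... | yes _ = 0
... | no  _ = edgeMult u v D + edgeMult u v C

unionMult-distinct : ∀ {n} (D C : List (Fin n)) {u v} → u ≢ v →
  unionMult D C u v ≡ edgeMult u v D + edgeMult u v C
unionMult-distinct D C {u} {v} u≢v with u ≟ᶠ v
... | yes u≡v = ⊥-elim (u≢v u≡v)
... | no  _   = refl

unionGraph : ∀ {n} (D C : List (Fin n)) → LongSimple D → LongSimple C → SubMultigraph2K n
unionGraph D C (D-unique , D-long) (C-unique , C-long) = record
  { mult = unionMult D C ; symm = symmetric ; loopless = no-loops ; atMost2 = at-most-2 }
  where
    symmetric : ∀ u v → unionMult D C u v ≡ unionMult D C v u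
    symmetric u v with u ≟ᶠ v | v ≟ᶠ u
    ... | yes _   | yes _   = refl
    ... | yes u≡v | no v≢u  = ⊥-elim (v≢u (sym u≡v))
    ... | no u≢v  | yes v≡u = ⊥-elim (u≢v (sym v≡u))
    ... | no _    | no _    = cong₂ _+_ (edgeMult-swap u v D) (edgeMult-swap u v C)
    no-loops : ∀ u → unionMult D C u u ≡ 0
    no-loops u with u ≟ᶠ u
    ... | yes _   = refl
    ... | no u≢u  = ⊥-elim (u≢u refl)
    at-most-2 : ∀ u v → unionMult D C u v ≤ 2
    at-most-2 u v with u ≟ᶠ v
    ... | yes _ = z≤n
    ... | no  _ = +-mono-≤ (edgeMult-simple u v D D-unique D-long) (edgeMult-simple u v C C-unique C-long)

union-decomposition : ∀ {n} {D C : List (Fin n)} (sD : LongSimple D) (sC : LongSimple C) {L Ys} →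
  Pointwise IsCycle L Ys →
  (∀ u v → u ≢ v → sum (map (edgeMult u v) Ys) ≡ edgeMult u v D + edgeMult u v C) →
  Decomposition (unionGraph D C sD sC) L
union-decomposition {D = D} {C} _ _ {Ys = Ys} cycles same =
  Ys , cycles , λ u v u≢v → trans (same u v u≢v) (sym (unionMult-distinct D C u≢v))

interval : ℕ → ℕ → List ℕ
interval a zero    = []
interval a (suc k) = a ∷ interval (suc a) k

length-interval : ∀ a k → length (interval a k) ≡ k
length-interval a zero    = refl
length-interval a (suc k) = cong suc (length-interval (suc a) k)

interval-snoc : ∀ a k → interval a (suc k) ≡ interval a k ++ [ a + k ]
interval-snoc a zero    = cong [_] (sym (+-identityʳ a))
interval-snoc a (suc k) = cong (a ∷_)
  (trans (interval-snoc (suc a) k) (cong (λ t → interval (suc a) k ++ [ t ]) (sym (+-suc a k))))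

interval-++ : ∀ a k l → interval a (k + l) ≡ interval a k ++ interval (a + k) l
interval-++ a zero    l = cong (λ t → interval t l) (sym (+-identityʳ a))
interval-++ a (suc k) l = cong (a ∷_)
  (trans (interval-++ (suc a) k l) (cong (λ t → interval (suc a) k ++ interval t l) (sym (+-suc a k))))

interval-above : ∀ a k → All (a ≤_) (interval a k)
interval-above a zero    = []
interval-above a (suc k) = ≤-refl ∷ All.map (≤-trans (n≤1+n a)) (interval-above (suc a) k)

interval-below : ∀ a k → All (_< a + k) (interval a k)
interval-below a zero    = []
interval-below a (suc k) =
  subst (λ t → All (_< t) (a ∷ interval (suc a) k)) (sym (+-suc a k))
    (s≤s (m≤m+n a k) ∷ interval-below (suc a) k)

interval-fresh : ∀ {c} a k → c < a → All (c ≢_) (interval a k)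
interval-fresh a k c<a = All.map (λ a≤t c≡t → <-irrefl c≡t (<-≤-trans c<a a≤t)) (interval-above a k)

interval-unique : ∀ a k → Unique (interval a k)
interval-unique a zero    = []
interval-unique a (suc k) = interval-fresh (suc a) k ≤-refl ∷ interval-unique (suc a) k

last-interval : ∀ c j → last c (interval (suc c) j) ≡ c + j
last-interval c zero    = sym (+-identityʳ c)
last-interval c (suc j) = trans (last-interval (suc c) j) (sym (+-suc c j))

-- A switch for the block lengths M with x spare vertices, on the vertices below
-- N = sum M + x, consists of
--   D = 0,Dt      a simple cycle of length sum M,
--   C = 0,Ct      and  B = 0,r,Bt  Hamilton cycles,
--   blocks        simple cycles of the lengths M,
-- such that D, C carry the same edges as blocks, B.  The edge condition is
-- stated for D, C, B with their closing edges at 0 removed; the anchors (C ends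
-- in r, D ends where B ends) say that these removed edges agree.
record Switch (M : List ℕ) (x : ℕ) : Set where
  field
    Dt Ct Bt       : List ℕ
    r              : ℕ
    blocks         : List (List ℕ)
    D-length       : length (0 ∷ Dt) ≡ sum M
    D-unique       : Unique (0 ∷ Dt)
    D-bounded      : All (_< sum M + x) (0 ∷ Dt)
    C-hamilton     : 0 ∷ Ct ↭ interval 0 (sum M + x)
    B-hamilton     : 0 ∷ r ∷ Bt ↭ interval 0 (sum M + x)
    C-anchor       : last 0 Ct ≡ r
    D-anchor       : last 0 Dt ≡ last r Bt
    blocks-shape   : Pointwise (λ k Y → length Y ≡ k × Unique Y) M blocks
    blocks-bounded : All (All (_< sum M + x)) blocks
    paths          : ∀ w → Symmetric w →
                     pathWeight w 0 Dt + pathWeight w 0 Ct ≡ totalWeight w blocks + pathWeight w r Bt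

switch-cycles : ∀ {M x} (S : Switch M x) → let open Switch S in ∀ w → Symmetric w →
  cycleWeight w (0 ∷ Dt) + cycleWeight w (0 ∷ Ct) ≡ totalWeight w blocks + cycleWeight w (0 ∷ r ∷ Bt)
switch-cycles S w w-sym = begin
  (PD + w (last 0 Dt , 0)) + (PC + w (last 0 Ct , 0))  ≡⟨ regroup PD PC (w (last 0 Dt , 0)) (w (last 0 Ct , 0)) ⟩
  (PD + PC) + (w (last 0 Dt , 0) + w (last 0 Ct , 0))  ≡⟨ cong₂ _+_ (paths w w-sym) closing ⟩
  (T + PB) + (w (last r Bt , 0) + w (0 , r))           ≡⟨ regroup′ T PB (w (last r Bt , 0)) (w (0 , r)) ⟩
  T + ((w (0 , r) + PB) + w (last r Bt , 0))           ∎
  where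
    open Switch S
    open ≡-Reasoning
    PD PC PB T : ℕ
    PD = pathWeight w 0 Dt
    PC = pathWeight w 0 Ct
    PB = pathWeight w r Bt
    T  = totalWeight w blocks
    closing : w (last 0 Dt , 0) + w (last 0 Ct , 0) ≡ w (last r Bt , 0) + w (0 , r)
    closing = cong₂ _+_ (cong (λ t → w (t , 0)) D-anchor) (trans (cong (λ t → w (t , 0)) C-anchor) (w-sym r 0))
    regroup : ∀ a b c d → (a + c) + (b + d) ≡ (a + b) + (c + d)
    regroup = solve-∀
    regroup′ : ∀ a b c d → (a + b) + (c + d) ≡ a + ((d + b) + c)
    regroup′ = solve-∀

-- One block of length a+2 on N = a+2+x vertices:
--   D = 0, x+1, …, N−1,   B = 0, 1, …, N−1,   C = B reversed,   blocks = [D].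
single-block : ∀ a x → Switch (suc (suc a) ∷ []) x
single-block a x = record
  { Dt = Dt ; Ct = last 1 Bt ∷ reversedWalk 1 Bt ; Bt = Bt ; r = 1 ; blocks = [ 0 ∷ Dt ]
  ; D-length       = trans D-length (sym (+-identityʳ _))
  ; D-unique       = D-unique
  ; D-bounded      = D-bounded
  ; C-hamilton     = ↭-prep 0 (reversedWalk-↭ 1 Bt)
  ; B-hamilton     = ↭-refl
  ; C-anchor       = last-reversedWalk 1 Bt
  ; D-anchor       = D-anchor
  ; blocks-shape   = (D-length , D-unique) ∷ []
  ; blocks-bounded = D-bounded ∷ []
  ; paths          = paths
  }
  where
    b : ℕ
    b  = (a + 0) + x
    Dt Bt : List ℕ
    Dt = interval (suc x) (suc a)
    Bt = interval 2 b
    D-length : length (0 ∷ Dt) ≡ suc (suc a)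
    D-length = cong suc (length-interval (suc x) (suc a))
    D-unique : Unique (0 ∷ Dt)
    D-unique = interval-fresh (suc x) (suc a) (s≤s z≤n) ∷ interval-unique (suc x) (suc a)
    a+x≡b : a + x ≡ b
    a+x≡b = cong (_+ x) (sym (+-identityʳ a))
    D-bounded : All (_< suc (suc b)) (0 ∷ Dt)
    D-bounded = s≤s z≤n ∷ subst (λ t → All (_< t) Dt) size (interval-below (suc x) (suc a))
      where
        size : suc x + suc a ≡ suc (suc b)
        size = cong suc (trans (+-suc x a) (cong suc (trans (+-comm x a) a+x≡b)))
    D-anchor : last 0 Dt ≡ last 1 Bt
    D-anchor = trans (last-interval (suc x) a) (trans (cong suc (trans (+-comm x a) a+x≡b)) (sym (last-interval 1 b)))
    paths : ∀ w → Symmetric w →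
      pathWeight w 0 Dt + pathWeight w 0 (last 1 Bt ∷ reversedWalk 1 Bt) ≡ totalWeight w [ 0 ∷ Dt ] + pathWeight w 1 Bt
    paths w w-sym = begin
      PD + (w (0 , last 1 Bt) + pathWeight w (last 1 Bt) (reversedWalk 1 Bt))
        ≡⟨ cong (λ t → PD + (w (0 , last 1 Bt) + t)) (pathWeight-reverse w w-sym 1 Bt) ⟩
      PD + (w (0 , last 1 Bt) + P1)
        ≡⟨ sym (+-assoc PD _ P1) ⟩
      (PD + w (0 , last 1 Bt)) + P1
        ≡⟨ cong (λ t → (PD + t) + P1) (trans (w-sym 0 _) (cong (λ t → w (t , 0)) (sym D-anchor))) ⟩
      (PD + w (last 0 Dt , 0)) + P1
        ≡⟨ cong (_+ P1) (sym (+-identityʳ _)) ⟩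
      totalWeight w [ 0 ∷ Dt ] + P1
        ∎
      where
        open ≡-Reasoning
        PD P1 : ℕ
        PD = pathWeight w 0 Dt
        P1 = pathWeight w 1 Bt

-- Adding a block of k = i+2 fresh vertices e, …, z (e = N, z = N+k−1):
--   D ↦ D followed by e, …, z,        C ↦ C followed by z, e, …, z−1,
--   B ↦ 0 followed by (z, r, Bt, e, …, z−1) reversed,   blocks ↦ (e, …, z) ∷ blocks.
add-block : ∀ i {M x} → Switch M x → Switch (suc (suc i) ∷ M) x
add-block i {M} {x} S = record
  { Dt = Dt ++ Y ; Ct = Ct ++ z ∷ e ∷ I ; Bt = reversedWalk z L ; r = last z L ; blocks = Y ∷ blocks
  ; D-length       = trans (length-++ (0 ∷ Dt)) (trans (cong₂ _+_ D-length Y-length) (+-comm (sum M) k))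
  ; D-unique       = Unique-++⁺ D-unique Y-unique D-disjoint-Y
  ; D-bounded      = All-++⁺ (All.map grow D-bounded) Y-bounded
  ; C-hamilton     = C-hamilton′
  ; B-hamilton     = B-hamilton′
  ; C-anchor       = trans (last-++ 0 Ct (z ∷ e ∷ I)) (sym (last-++ r Bt (e ∷ I)))
  ; D-anchor       = trans (trans (last-++ 0 Dt Y) (last-++ e I [ z ])) (sym (last-reversedWalk z L))
  ; blocks-shape   = (Y-length , Y-unique) ∷ blocks-shape
  ; blocks-bounded = Y-bounded ∷ All.map (All.map grow) blocks-bounded
  ; paths          = λ w w-sym →
      trans (switch-identity w w-sym 0 Dt Ct r Bt e I z (totalWeight w blocks) C-anchor D-anchor (paths w w-sym))
            (cong (cycleWeight w Y + totalWeight w blocks +_) (sym (pathWeight-reverse w w-sym z L)))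
  }
  where
    open Switch S
    k e N′ z : ℕ
    k  = suc (suc i)
    e  = sum M + x
    N′ = (k + sum M) + x
    z  = suc e + i
    I Y L : List ℕ
    I  = interval (suc e) i
    Y  = e ∷ I ++ [ z ]
    L  = r ∷ Bt ++ e ∷ I
    Y-interval : interval e k ≡ Y
    Y-interval = cong (e ∷_) (interval-snoc (suc e) i)
    size : e + k ≡ N′
    size = rotate (sum M) x k
      where
        rotate : ∀ a b c → (a + b) + c ≡ (c + a) + b
        rotate = solve-∀
    grow : ∀ {t} → t < e → t < N′
    grow t<e = <-≤-trans t<e (≤-trans (m≤m+n e k) (≤-reflexive size))
    Y-length : length Y ≡ k
    Y-length = subst (λ Z → length Z ≡ k) Y-interval (length-interval e k)
    Y-unique : Unique Y
    Y-unique = subst Unique Y-interval (interval-unique e k)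
    Y-bounded : All (_< N′) Y
    Y-bounded = subst (λ Z → All (_< N′) Z) Y-interval
      (subst (λ t → All (_< t) (interval e k)) size (interval-below e k))
    D-disjoint-Y : ∀ {t} → ¬ (t ∈ 0 ∷ Dt × t ∈ Y)
    D-disjoint-Y (t∈D , t∈Y) = <-irrefl refl (<-≤-trans (All.lookup D-bounded t∈D) (All.lookup Y-above t∈Y))
      where
        Y-above : All (e ≤_) Y
        Y-above = subst (All (e ≤_)) Y-interval (interval-above e k)
    range : interval 0 e ++ Y ≡ interval 0 N′
    range = trans (cong (interval 0 e ++_) (sym Y-interval)) (trans (sym (interval-++ 0 e k)) (cong (interval 0) size))
    C-hamilton′ : 0 ∷ Ct ++ z ∷ e ∷ I ↭ interval 0 N′
    C-hamilton′ = begin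
      (0 ∷ Ct) ++ z ∷ e ∷ I  ↭⟨ ↭-++⁺ C-hamilton (∷↭∷ʳ z (e ∷ I)) ⟩
      interval 0 e ++ Y      ≡⟨ range ⟩
      interval 0 N′          ∎
      where open PermutationReasoning
    B-hamilton′ : 0 ∷ last z L ∷ reversedWalk z L ↭ interval 0 N′
    B-hamilton′ = begin
      0 ∷ last z L ∷ reversedWalk z L  ↭⟨ ↭-prep 0 (reversedWalk-↭ z L) ⟩
      0 ∷ z ∷ L                        ↭⟨ ↭-prep 0 (∷↭∷ʳ z L) ⟩
      0 ∷ L ++ [ z ]                   ≡⟨ cong (0 ∷_) (++-assoc (r ∷ Bt) (e ∷ I) [ z ]) ⟩
      (0 ∷ r ∷ Bt) ++ Y                ↭⟨ ↭-++⁺ B-hamilton ↭-refl ⟩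
      interval 0 e ++ Y                ≡⟨ range ⟩
      interval 0 N′                    ∎
      where open PermutationReasoning

switch : ∀ k M x → All (2 ≤_) (k ∷ M) → Switch (k ∷ M) x
switch (suc (suc a)) []      x (s≤s (s≤s _) ∷ [])  = single-block a x
switch (suc (suc i)) (k ∷ M) x (s≤s (s≤s _) ∷ k≥2) = add-block i (switch k M x k≥2)

permutation-shape : ∀ {L N} → L ↭ interval 0 N → length L ≡ N × Unique L
permutation-shape {N = N} L↭ =
  trans (↭-length L↭) (length-interval 0 N) , Unique-resp-↭ (↭⇒↭ₛ (↭-sym L↭)) (interval-unique 0 N)

permutation-bounded : ∀ {L N} → L ↭ interval 0 N → All (_< N) L
permutation-bounded {N = N} L↭ = All-resp-↭ (↭-sym L↭) (interval-below 0 N)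

map-unique-on : ∀ {P : A → Set} (f : A → A′) → (∀ {a b} → P a → P b → f a ≡ f b → a ≡ b) →
  ∀ {L} → All P L → Unique L → Unique (map f L)
map-unique-on         f inj []        []         = []
map-unique-on {P = P} f inj (pa ∷ ps) (a≢ ∷ uq) = fresh pa ps a≢ ∷ map-unique-on f inj ps uq
  where
    fresh : ∀ {a L} → P a → All P L → All (a ≢_) L → All (f a ≢_) (map f L)
    fresh pa []        []          = []
    fresh pa (pb ∷ ps) (a≢b ∷ a≢s) = (a≢b ∘ inj pa pb) ∷ fresh pa ps a≢s

module Renaming (n : ℕ) {{_ : NonZero n}} where

  vertex : ℕ → Fin n
  vertex t = t mod n

  vertex-injective : ∀ {a b} → a < n → b < n → vertex a ≡ vertex b → a ≡ b
  vertex-injective {a} {b} a<n b<n eq = begin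
    a      ≡⟨ sym (m<n⇒m%n≡m a<n) ⟩
    a % n  ≡⟨ fromℕ<-injective (a % n) (b % n) (m%n<n a n) (m%n<n b n) eq ⟩
    b % n  ≡⟨ m<n⇒m%n≡m b<n ⟩
    b      ∎
    where open ≡-Reasoning

  vertex-cycle : ∀ {l L} → length L ≡ l × Unique L → 2 ≤ l → All (_< n) L → IsCycle l (map vertex L)
  vertex-cycle {L = L} (len , uq) 2≤l below =
    trans (length-map vertex L) len , 2≤l , map-unique-on vertex vertex-injective below uq

  vertex-cycles : ∀ {ls Ls} → Pointwise (λ l L → length L ≡ l × Unique L) ls Ls → All (2 ≤_) ls →
    All (All (_< n)) Ls → Pointwise IsCycle ls (map (map vertex) Ls)
  vertex-cycles []               []           []             = []
  vertex-cycles (shape ∷ shapes) (2≤l ∷ 2≤ls) (below ∷ belows) =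
    vertex-cycle shape 2≤l below ∷ vertex-cycles shapes 2≤ls belows

  edgeMult-vertex : ∀ u v L → edgeMult u v (map vertex L) ≡ cycleWeight (pullback vertex (joins u v)) L
  edgeMult-vertex u v L = trans (edgeMult-cycleWeight u v (map vertex L)) (cycleWeight-map vertex (joins u v) L)

  edgeCount-vertex : ∀ u v Ls →
    sum (map (edgeMult u v) (map (map vertex) Ls)) ≡ totalWeight (pullback vertex (joins u v)) Ls
  edgeCount-vertex u v []       = refl
  edgeCount-vertex u v (L ∷ Ls) = cong₂ _+_ (edgeMult-vertex u v L) (edgeCount-vertex u v Ls)

realise : ∀ {M x} → Switch M x → 3 ≤ sum M → All (2 ≤_) M →
  Σ (SubMultigraph2K (sum M + x)) λ G →
    Decomposition G (M ++ [ sum M + x ]) × Decomposition G (sum M ∷ sum M + x ∷ [])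
realise {M} {x} S 3≤m M≥2 =
    unionGraph D C D-simple C-simple
  , union-decomposition D-simple C-simple blocks-cycles same-edges
  , union-decomposition D-simple C-simple (D-cycle ∷ C-cycle ∷ [])
      (λ u v _ → cong (edgeMult u v D +_) (+-identityʳ _))
  where
    open Switch S
    N : ℕ
    N = sum M + x
    3≤N : 3 ≤ N
    3≤N = ≤-trans 3≤m (m≤m+n (sum M) x)
    open Renaming N {{>-nonZero (≤-trans (s≤s z≤n) 3≤N)}}
    B : List ℕ
    B = 0 ∷ r ∷ Bt
    D C : List (Fin N)
    D = map vertex (0 ∷ Dt)
    C = map vertex (0 ∷ Ct)
    D-cycle : IsCycle (sum M) D
    D-cycle = vertex-cycle (D-length , D-unique) (≤-trans (n≤1+n 2) 3≤m) D-bounded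
    C-cycle : IsCycle N C
    C-cycle = vertex-cycle (permutation-shape C-hamilton) (≤-trans (n≤1+n 2) 3≤N) (permutation-bounded C-hamilton)
    blocks-cycles : Pointwise IsCycle (M ++ [ N ]) (map (map vertex) (blocks ++ [ B ]))
    blocks-cycles = vertex-cycles (Pointwise-++⁺ blocks-shape (permutation-shape B-hamilton ∷ []))
      (All-++⁺ M≥2 (≤-trans (n≤1+n 2) 3≤N ∷ [])) (All-++⁺ blocks-bounded (permutation-bounded B-hamilton ∷ []))
    long : ∀ {l} {L : List (Fin N)} → IsCycle l L → 3 ≤ l → LongSimple L
    long (len , _ , uq) 3≤l = uq , subst (3 ≤_) (sym len) 3≤l
    D-simple : LongSimple D
    D-simple = long D-cycle 3≤m
    C-simple : LongSimple C
    C-simple = long C-cycle 3≤N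
    same-edges : ∀ u v → u ≢ v →
      sum (map (edgeMult u v) (map (map vertex) (blocks ++ [ B ]))) ≡ edgeMult u v D + edgeMult u v C
    same-edges u v _ = begin
      sum (map (edgeMult u v) (map (map vertex) (blocks ++ [ B ])))
        ≡⟨ edgeCount-vertex u v (blocks ++ [ B ]) ⟩
      totalWeight w (blocks ++ [ B ])
        ≡⟨ totalWeight-snoc w blocks B ⟩
      totalWeight w blocks + cycleWeight w B
        ≡⟨ sym (switch-cycles S w (λ a b → joins-sym u v (vertex a) (vertex b))) ⟩
      cycleWeight w (0 ∷ Dt) + cycleWeight w (0 ∷ Ct)
        ≡⟨ sym (cong₂ _+_ (edgeMult-vertex u v (0 ∷ Dt)) (edgeMult-vertex u v (0 ∷ Ct))) ⟩
      edgeMult u v D + edgeMult u v C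
        ∎
      where
        open ≡-Reasoning
        w : Weight ℕ
        w = pullback vertex (joins u v)

lemma7p8 : (n m : ℕ) (M : List ℕ) → 3 ≤ m → m ≤ n → sum M ≡ m → All (2 ≤_) M →
    Σ (SubMultigraph2K n) λ G → Decomposition G (M ++ [ n ]) × Decomposition G (m ∷ n ∷ [])
lemma7p8 n _ []      ()  _   refl _
lemma7p8 n _ (k ∷ M) 3≤m m≤n refl M≥2 =
  subst Goal (m+[n∸m]≡n m≤n) (realise (switch k M (n ∸ m) M≥2) 3≤m M≥2)
  where
    m : ℕ
    m = sum (k ∷ M)
    Goal : ℕ → Set
    Goal N = Σ (SubMultigraph2K N) λ G → Decomposition G ((k ∷ M) ++ [ N ]) × Decomposition G (m ∷ N ∷ [])
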